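{- For every $r\in\mathbb N$, all coefficients of the $q$-series expansion of \[ (-q;q^2)_\infty\left(\sum_{k=0}^{\infty}\frac{q^{2(2kr+1)}}{1-q^{2(2kr+1)}}-\sum_{k=1}^{\infty}\frac{q^{2kr}}{1-q^{4kr}}\right) \] are non-negative.
   Context: $(a;q)_\infty:=\prod_{j=0}^\infty(1-aq^j)$; series are formal power series in $q$. -}

module Defs where

open import Data.Nat using (ℕ; zero; suc; _+_; _∸_) renaming (_*_ to _*ℕ_)
open import Data.Nat.Properties using (_≟_)
open import Data.Integer using (ℤ; 0ℤ; 1ℤ; -1ℤ) renaming (_+_ to _+ℤ_; _*_ to _*ℤ_; _-_ to _-ℤ_)
open import Data.Bool using (if_then_else_)
open import Relation.Nullary using (does)

-- Formal power series in q with integer coefficients: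
-- a series is its coefficient function, n ↦ [q^n].
Series : Set
Series = ℕ → ℤ

sumRange : ℕ → (ℕ → ℤ) → ℤ
sumRange zero    f = 0ℤ
sumRange (suc n) f = sumRange n f +ℤ f n

oneₛ : Series
oneₛ zero    = 1ℤ
oneₛ (suc _) = 0ℤ

mono : ℤ → ℕ → Series
mono c e n = if does (e ≟ n) then c else 0ℤ

_+ₛ_ : Series → Series → Series
(f +ₛ g) n = f n +ℤ g n

_-ₛ_ : Series → Series → Series
(f -ₛ g) n = f n -ℤ g n

_*ₛ_ : Series → Series → Series
(f *ₛ g) n = sumRange (suc n) (λ i → f i *ℤ g (n ∸ i))

prodRange : ℕ → (ℕ → Series) → Series
prodRange zero    f = oneₛ
prodRange (suc m) f = prodRange m f *ₛ f m

-- 1/(1 - q^a) = Σ_{m ≥ 0} q^{a m}   (meaningful for a ≥ 1; then only m ≤ n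
-- can contribute to the coefficient of q^n)
inv1m : ℕ → Series
inv1m a n = sumRange (suc n) (λ m → if does ((a *ℕ m) ≟ n) then 1ℤ else 0ℤ)

-- Infinite sum  Σ_{k ≥ k0} f k  of a family with ord(f (k0 + i)) > i
-- (so f (k0+i) contributes nothing to [q^n] once i > n).
infSum : ℕ → (ℕ → Series) → Series
infSum k0 f n = sumRange (suc n) (λ i → f (k0 + i) n)

-- q-Pochhammer symbol (c q^e ; q^b)_∞ = Π_{j ≥ 0} (1 - c q^{e + b j}),
-- for e ≥ 1, b ≥ 1: the factors with j > n are ≡ 1 mod q^{n+1}, so
-- [q^n] of the infinite product is [q^n] of the partial product over j ≤ n.
poch∞ : ℤ → ℕ → ℕ → Series
poch∞ c e b n = prodRange (suc n) (λ j → oneₛ -ₛ mono c (e + b *ℕ j)) n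

sum1 : ℕ → Series
sum1 r = infSum 0 (λ k → mono 1ℤ (2 *ℕ (2 *ℕ k *ℕ r + 1)) *ₛ inv1m (2 *ℕ (2 *ℕ k *ℕ r + 1)))

sum2 : ℕ → Series
sum2 r = infSum 1 (λ k → mono 1ℤ (2 *ℕ k *ℕ r) *ₛ inv1m (4 *ℕ k *ℕ r))

thm61Series : ℕ → Series
thm61Series r = poch∞ -1ℤ 1 2 *ₛ (sum1 r -ₛ sum2 r)

{-# OPTIONS --safe #-}
-- Write F = (-q;q²)_∞, the generating function of partitions into distinct odd
-- parts, with F = 0 at negative arguments. Expanding both Lambert series, the
-- coefficient of q^M is
--   Σ_{i,t} ( F(M - e₁(i,t)) - F(M - e₂(t,i)) ),
-- where e₁(i,t) = 2(2ir+1)(t+1) and e₂(t,i) = 2(t+1)r(2i+1) = e₁(i,t) + 2(t+1)(r-1).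
-- Multiplying by 1 + q^(2m+1) adds a copy shifted by 2m+1; comparing the partial
-- products over the first m and m+1 odd parts in this way gives F(n) ≤ F(n+2) for
-- n ≥ 1, hence F(n) ≤ F(n+2j) except for F(2) = 0 < F(0) = 1. So every paired
-- difference is non-negative unless r = 2, t = 0 and M = 8i+4; that single -1 is
-- cancelled by the term i = 0, t = 4i+1, which is F(0) - 0 = 1.
module Submission where

open import Defs
open import Data.Nat using (ℕ; zero; suc; _+_; _*_; _∸_; _≤_; _<_; z≤n; s≤s; _≤?_; _≟_; >-nonZero)
import Data.Nat.Properties as ℕ
open import Data.Nat.DivMod using (_%_; _/_; m≡m%n+[m/n]*n; [m+kn]%n≡m%n)
open import Data.Integer using (ℤ; 0ℤ; 1ℤ; -1ℤ; -_; +≤+)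
  renaming (_+_ to _+ℤ_; _*_ to _*ℤ_; _-_ to _-ℤ_; _≤_ to _≤ℤ_)
import Data.Integer.Properties as ℤ
open import Data.Bool using (if_then_else_)
open import Data.Sum using (inj₁; inj₂)
open import Data.Product using (∃; _×_; _,_; proj₁; proj₂)
open import Function using (_∘_)
open import Function.Bundles using (_⇔_; mk⇔; Equivalence)
open import Relation.Nullary using (Dec; yes; no; does; contradiction)
open import Relation.Nullary.Decidable using (dec-true; dec-false)
open import Relation.Binary.PropositionalEquality
open import Algebra.Properties.CommutativeSemigroup ℤ.+-commutativeSemigroup using (interchange)
import Data.Nat.Tactic.RingSolver as ℕ-Solver

∀<-init : ∀ {n} {P : ℕ → Set} → (∀ k → k < suc n → P k) → ∀ k → k < n → P k
∀<-init h k k<n = h k (ℕ.m<n⇒m<1+n k<n)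

∀<-last : ∀ {n} {P : ℕ → Set} → (∀ k → k < suc n → P k) → P n
∀<-last h = h _ ℕ.≤-refl

m<1+n∧m≢n⇒m<n : ∀ {k n} → k < suc n → k ≢ n → k < n
m<1+n∧m≢n⇒m<n k<1+n k≢n = ℕ.≤∧≢⇒< (ℕ.≤-pred k<1+n) k≢n

sumRange-cong : ∀ n {f g : ℕ → ℤ} → (∀ k → k < n → f k ≡ g k) →
                sumRange n f ≡ sumRange n g
sumRange-cong zero    f≗g = refl
sumRange-cong (suc n) f≗g = cong₂ _+ℤ_ (sumRange-cong n (∀<-init f≗g)) (∀<-last f≗g)

sumRange-zero : ∀ n {f : ℕ → ℤ} → (∀ k → k < n → f k ≡ 0ℤ) → sumRange n f ≡ 0ℤ
sumRange-zero zero    f≗0 = refl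
sumRange-zero (suc n) f≗0 = cong₂ _+ℤ_ (sumRange-zero n (∀<-init f≗0)) (∀<-last f≗0)

sumRange-single : ∀ n a {f : ℕ → ℤ} → a < n → (∀ k → k < n → k ≢ a → f k ≡ 0ℤ) →
                  sumRange n f ≡ f a
sumRange-single (suc n) a {f} a<1+n others with a ≟ n
... | yes refl = trans (cong (_+ℤ f a) (sumRange-zero n (λ k k<n → ∀<-init others k k<n (ℕ.<⇒≢ k<n))))
                       (ℤ.+-identityˡ (f a))
... | no a≢n   = trans (cong₂ _+ℤ_ (sumRange-single n a (m<1+n∧m≢n⇒m<n a<1+n a≢n) (∀<-init others))
                                   (∀<-last others (a≢n ∘ sym)))
                       (ℤ.+-identityʳ (f a))

sumRange-+ : ∀ n (f g : ℕ → ℤ) → sumRange n (λ k → f k +ℤ g k) ≡ sumRange n f +ℤ sumRange n g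
sumRange-+ zero    f g = refl
sumRange-+ (suc n) f g = trans (cong (_+ℤ (f n +ℤ g n)) (sumRange-+ n f g))
                               (interchange (sumRange n f) (sumRange n g) (f n) (g n))

sumRange-neg : ∀ n (f : ℕ → ℤ) → sumRange n (λ k → - f k) ≡ - sumRange n f
sumRange-neg zero    f = refl
sumRange-neg (suc n) f = trans (cong (_+ℤ - f n) (sumRange-neg n f))
                               (sym (ℤ.neg-distrib-+ (sumRange n f) (f n)))

sumRange-- : ∀ n (f g : ℕ → ℤ) → sumRange n (λ k → f k -ℤ g k) ≡ sumRange n f -ℤ sumRange n g
sumRange-- n f g = trans (sumRange-+ n f (λ k → - g k)) (cong (sumRange n f +ℤ_) (sumRange-neg n g))

sumRange-*ˡ : ∀ n c (f : ℕ → ℤ) → sumRange n (λ k → c *ℤ f k) ≡ c *ℤ sumRange n f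
sumRange-*ˡ zero    c f = sym (ℤ.*-zeroʳ c)
sumRange-*ˡ (suc n) c f = trans (cong (_+ℤ c *ℤ f n) (sumRange-*ˡ n c f))
                                (sym (ℤ.*-distribˡ-+ c (sumRange n f) (f n)))

sumRange-swap : ∀ n m (f : ℕ → ℕ → ℤ) →
                sumRange n (λ a → sumRange m (f a)) ≡ sumRange m (λ b → sumRange n (λ a → f a b))
sumRange-swap n zero    f = sumRange-zero n (λ _ _ → refl)
sumRange-swap n (suc m) f = trans (sumRange-+ n (λ a → sumRange m (f a)) (λ a → f a m))
                                  (cong (_+ℤ sumRange n (λ a → f a m)) (sumRange-swap n m f))

sumRange-extend : ∀ n d {f : ℕ → ℤ} → (∀ k → n ≤ k → f k ≡ 0ℤ) →
                  sumRange n f ≡ sumRange (d + n) f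
sumRange-extend n zero    f≗0 = refl
sumRange-extend n (suc d) {f} f≗0 = trans (sumRange-extend n d f≗0)
  (sym (trans (cong (sumRange (d + n) f +ℤ_) (f≗0 (d + n) (ℕ.m≤n+m n d))) (ℤ.+-identityʳ _)))

sumRange-extend-≤ : ∀ {n m} {f : ℕ → ℤ} → n ≤ m → (∀ k → n ≤ k → f k ≡ 0ℤ) →
                    sumRange n f ≡ sumRange m f
sumRange-extend-≤ {n} {m} {f} n≤m f≗0 =
  trans (sumRange-extend n (m ∸ n) f≗0) (cong (λ x → sumRange x f) (ℕ.m∸n+n≡m n≤m))

sumRange-nonneg : ∀ n {f : ℕ → ℤ} → (∀ k → k < n → 0ℤ ≤ℤ f k) → 0ℤ ≤ℤ sumRange n f
sumRange-nonneg zero    f≥0 = ℤ.≤-refl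
sumRange-nonneg (suc n) f≥0 = ℤ.+-mono-≤ (sumRange-nonneg n (∀<-init f≥0)) (∀<-last f≥0)

sumRange-≥-term : ∀ n a {f : ℕ → ℤ} → a < n → (∀ k → k < n → k ≢ a → 0ℤ ≤ℤ f k) →
                  f a ≤ℤ sumRange n f
sumRange-≥-term (suc n) a {f} a<1+n others with a ≟ n
... | yes refl = ℤ.≤-trans (ℤ.≤-reflexive (sym (ℤ.+-identityˡ (f a))))
                   (ℤ.+-monoˡ-≤ (f a) (sumRange-nonneg n (λ k k<n → ∀<-init others k k<n (ℕ.<⇒≢ k<n))))
... | no a≢n   = ℤ.≤-trans (ℤ.≤-reflexive (sym (ℤ.+-identityʳ (f a))))
                   (ℤ.+-mono-≤ (sumRange-≥-term n a (m<1+n∧m≢n⇒m<n a<1+n a≢n) (∀<-init others))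
                               (∀<-last others (a≢n ∘ sym)))

sumRange-nonneg-except : ∀ n a b {f : ℕ → ℤ} → a < n → b < n → b ≢ a →
                         (∀ k → k < n → k ≢ a → 0ℤ ≤ℤ f k) → 0ℤ ≤ℤ f a +ℤ f b →
                         0ℤ ≤ℤ sumRange n f
sumRange-nonneg-except (suc n) a b {f} a<1+n b<1+n b≢a others total with n ≟ a | n ≟ b
... | yes refl | _ =
  ℤ.≤-trans total (ℤ.≤-trans (ℤ.≤-reflexive (ℤ.+-comm (f a) (f b)))
    (ℤ.+-monoˡ-≤ (f a) (sumRange-≥-term n b (m<1+n∧m≢n⇒m<n b<1+n b≢a)
                          (λ k k<n _ → ∀<-init others k k<n (ℕ.<⇒≢ k<n)))))
... | no _ | yes refl =
  ℤ.≤-trans total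
    (ℤ.+-monoˡ-≤ (f b) (sumRange-≥-term n a (m<1+n∧m≢n⇒m<n a<1+n (b≢a ∘ sym)) (∀<-init others)))
... | no n≢a | no n≢b =
  ℤ.+-mono-≤ (sumRange-nonneg-except n a b (m<1+n∧m≢n⇒m<n a<1+n (n≢a ∘ sym))
                                           (m<1+n∧m≢n⇒m<n b<1+n (n≢b ∘ sym)) b≢a (∀<-init others) total)
             (∀<-last others n≢a)

doubleSum-nonneg-except : ∀ n m (D : ℕ → ℕ → ℤ) a₁ a₂ b₁ b₂ →
  a₁ < n → a₂ < m → b₁ < n → b₂ < m → b₂ ≢ a₂ →
  (∀ i t → i < n → t < m → (i , t) ≢ (a₁ , a₂) → 0ℤ ≤ℤ D i t) →
  0ℤ ≤ℤ D a₁ a₂ +ℤ D b₁ b₂ → 0ℤ ≤ℤ sumRange n (λ i → sumRange m (D i))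
doubleSum-nonneg-except n m D a₁ a₂ b₁ b₂ a₁<n a₂<m b₁<n b₂<m b₂≢a₂ others total
  with b₁ ≟ a₁
... | yes refl = sumRange-nonneg n row
  where
  row : ∀ i → i < n → 0ℤ ≤ℤ sumRange m (D i)
  row i i<n with i ≟ a₁
  ... | yes refl = sumRange-nonneg-except m a₂ b₂ a₂<m b₂<m b₂≢a₂
                     (λ t t<m t≢a₂ → others i t i<n t<m (t≢a₂ ∘ cong proj₂)) total
  ... | no i≢a₁  = sumRange-nonneg m (λ t t<m → others i t i<n t<m (i≢a₁ ∘ cong proj₁))
... | no b₁≢a₁ = sumRange-nonneg-except n a₁ b₁ a₁<n b₁<n b₁≢a₁
    (λ i i<n i≢a₁ → sumRange-nonneg m (λ t t<m → others i t i<n t<m (i≢a₁ ∘ cong proj₁)))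
    (ℤ.≤-trans total (ℤ.+-mono-≤ row-a row-b))
  where
  row-a : D a₁ a₂ ≤ℤ sumRange m (D a₁)
  row-a = sumRange-≥-term m a₂ a₂<m (λ t t<m t≢a₂ → others a₁ t a₁<n t<m (t≢a₂ ∘ cong proj₂))
  row-b : D b₁ b₂ ≤ℤ sumRange m (D b₁)
  row-b = sumRange-≥-term m b₂ b₂<m (λ t t<m _ → others b₁ t b₁<n t<m (b₁≢a₁ ∘ cong proj₁))

-- Coefficients of products of power series

shift : ℕ → Series → Series
shift e f n with e ≤? n
... | yes _ = f (n ∸ e)
... | no  _ = 0ℤ

shift-≥ : ∀ e f {n} → e ≤ n → shift e f n ≡ f (n ∸ e)
shift-≥ e f {n} e≤n with e ≤? n
... | yes _   = refl
... | no  e≰n = contradiction e≤n e≰n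

shift-< : ∀ e f {n} → n < e → shift e f n ≡ 0ℤ
shift-< e f {n} n<e with e ≤? n
... | yes e≤n = contradiction e≤n (ℕ.<⇒≱ n<e)
... | no  _   = refl

shift-self : ∀ f n → shift n f n ≡ f 0
shift-self f n = trans (shift-≥ n f ℕ.≤-refl) (cong f (ℕ.n∸n≡0 n))

shift-nonneg : ∀ e {f} n → (∀ k → 0ℤ ≤ℤ f k) → 0ℤ ≤ℤ shift e f n
shift-nonneg e {f} n f≥0 with e ≤? n
... | yes _ = f≥0 (n ∸ e)
... | no  _ = ℤ.≤-refl

mono-≡ : ∀ c e → mono c e e ≡ c
mono-≡ c e = cong (λ b → if b then c else 0ℤ) (dec-true (e ≟ e) refl)

mono-≢ : ∀ c e n → e ≢ n → mono c e n ≡ 0ℤ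
mono-≢ c e n e≢n = cong (λ b → if b then c else 0ℤ) (dec-false (e ≟ n) e≢n)

mono-< : ∀ c e n → n < e → mono c e n ≡ 0ℤ
mono-< c e n n<e = mono-≢ c e n (ℕ.>⇒≢ n<e)

mono-cong : ∀ c {x y x′ y′} → x ≡ y ⇔ x′ ≡ y′ → mono c x y ≡ mono c x′ y′
mono-cong c {x} {y} {x′} {y′} x≡y⇔x′≡y′ = cong (λ b → if b then c else 0ℤ) does≡
  where
  open Equivalence x≡y⇔x′≡y′
  does≡ : does (x ≟ y) ≡ does (x′ ≟ y′)
  does≡ with x ≟ y
  ... | yes x≡y = trans (dec-true (x ≟ y) x≡y) (sym (dec-true (x′ ≟ y′) (to x≡y)))
  ... | no  x≢y = trans (dec-false (x ≟ y) x≢y) (sym (dec-false (x′ ≟ y′) (x≢y ∘ from)))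

*ₛ-congʳ : ∀ f {g h : Series} M → (∀ k → k ≤ M → g k ≡ h k) → (f *ₛ g) M ≡ (f *ₛ h) M
*ₛ-congʳ f M g≗h = sumRange-cong (suc M) (λ j _ → cong (f j *ℤ_) (g≗h (M ∸ j) (ℕ.m∸n≤m M j)))

*ₛ-distribˡ--ₛ : ∀ f g h n → (f *ₛ (g -ₛ h)) n ≡ (f *ₛ g) n -ℤ (f *ₛ h) n
*ₛ-distribˡ--ₛ f g h n =
  trans (sumRange-cong (suc n) (λ j _ → *-distribˡ-- (f j) (g (n ∸ j)) (h (n ∸ j))))
        (sumRange-- (suc n) _ _)
  where
  *-distribˡ-- : ∀ a b c → a *ℤ (b -ℤ c) ≡ a *ℤ b -ℤ a *ℤ c
  *-distribˡ-- a b c = trans (ℤ.*-distribˡ-+ a b (- c)) (cong (a *ℤ b +ℤ_) (sym (ℤ.neg-distribʳ-* a c)))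

*ₛ-sumRange : ∀ f K (g : ℕ → Series) M →
              (f *ₛ (λ n → sumRange K (λ i → g i n))) M ≡ sumRange K (λ i → (f *ₛ g i) M)
*ₛ-sumRange f K g M =
  trans (sumRange-cong (suc M) (λ j _ → sym (sumRange-*ˡ K (f j) (λ i → g i (M ∸ j)))))
        (sumRange-swap (suc M) K (λ j i → f j *ℤ g i (M ∸ j)))

*ₛ-mono : ∀ f c e n → (f *ₛ mono c e) n ≡ shift e f n *ℤ c
*ₛ-mono f c e n with ℕ.≤-<-connex e n
... | inj₁ e≤n = begin
    (f *ₛ mono c e) n
  ≡⟨ sumRange-single (suc n) (n ∸ e) (s≤s (ℕ.m∸n≤m n e)) off-diagonal ⟩
    f (n ∸ e) *ℤ mono c e (n ∸ (n ∸ e))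
  ≡⟨ cong (λ x → f (n ∸ e) *ℤ mono c e x) (ℕ.m∸[m∸n]≡n e≤n) ⟩
    f (n ∸ e) *ℤ mono c e e
  ≡⟨ cong₂ _*ℤ_ (sym (shift-≥ e f e≤n)) (mono-≡ c e) ⟩
    shift e f n *ℤ c ∎
  where
  open ≡-Reasoning
  off-diagonal : ∀ j → j < suc n → j ≢ n ∸ e → f j *ℤ mono c e (n ∸ j) ≡ 0ℤ
  off-diagonal j j<1+n j≢n∸e = trans (cong (f j *ℤ_) (mono-≢ c e (n ∸ j) λ e≡n∸j →
      j≢n∸e (trans (sym (ℕ.m∸[m∸n]≡n (ℕ.≤-pred j<1+n))) (cong (n ∸_) (sym e≡n∸j)))))
    (ℤ.*-zeroʳ (f j))
... | inj₂ n<e = trans (sumRange-zero (suc n) vanish)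
                      (sym (trans (cong (_*ℤ c) (shift-< e f n<e)) (ℤ.*-zeroˡ c)))
  where
  vanish : ∀ j → j < suc n → f j *ℤ mono c e (n ∸ j) ≡ 0ℤ
  vanish j _ = trans (cong (f j *ℤ_) (mono-≢ c e (n ∸ j) λ e≡n∸j →
                 ℕ.<⇒≱ n<e (subst (_≤ n) (sym e≡n∸j) (ℕ.m∸n≤m n j))))
               (ℤ.*-zeroʳ (f j))

mono-*ₛ : ∀ c e g n → (mono c e *ₛ g) n ≡ c *ℤ shift e g n
mono-*ₛ c e g n with ℕ.≤-<-connex e n
... | inj₁ e≤n = trans (sumRange-single (suc n) e (s≤s e≤n) off-diagonal)
                      (cong₂ _*ℤ_ (mono-≡ c e) (sym (shift-≥ e g e≤n)))
  where
  off-diagonal : ∀ j → j < suc n → j ≢ e → mono c e j *ℤ g (n ∸ j) ≡ 0ℤ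
  off-diagonal j _ j≢e =
    trans (cong (_*ℤ g (n ∸ j)) (mono-≢ c e j (j≢e ∘ sym))) (ℤ.*-zeroˡ (g (n ∸ j)))
... | inj₂ n<e = trans (sumRange-zero (suc n) vanish)
                      (sym (trans (cong (c *ℤ_) (shift-< e g n<e)) (ℤ.*-zeroʳ c)))
  where
  vanish : ∀ j → j < suc n → mono c e j *ℤ g (n ∸ j) ≡ 0ℤ
  vanish j j<1+n =
    trans (cong (_*ℤ g (n ∸ j)) (mono-≢ c e j λ { refl → ℕ.<⇒≱ n<e (ℕ.≤-pred j<1+n) }))
          (ℤ.*-zeroˡ (g (n ∸ j)))

*ₛ-oneₛ : ∀ f n → (f *ₛ oneₛ) n ≡ f n
*ₛ-oneₛ f n = begin
    (f *ₛ oneₛ) n        ≡⟨ *ₛ-congʳ f n (λ k _ → oneₛ≗mono k) ⟩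
    (f *ₛ mono 1ℤ 0) n   ≡⟨ *ₛ-mono f 1ℤ 0 n ⟩
    shift 0 f n *ℤ 1ℤ    ≡⟨ ℤ.*-identityʳ _ ⟩
    shift 0 f n          ≡⟨ shift-≥ 0 f z≤n ⟩
    f n                  ∎
  where
  open ≡-Reasoning
  oneₛ≗mono : ∀ k → oneₛ k ≡ mono 1ℤ 0 k
  oneₛ≗mono zero    = refl
  oneₛ≗mono (suc k) = refl

*ₛ-1+q^ : ∀ f e n → (f *ₛ (oneₛ -ₛ mono -1ℤ e)) n ≡ f n +ℤ shift e f n
*ₛ-1+q^ f e n = begin
    (f *ₛ (oneₛ -ₛ mono -1ℤ e)) n
  ≡⟨ *ₛ-distribˡ--ₛ f oneₛ (mono -1ℤ e) n ⟩
    (f *ₛ oneₛ) n -ℤ (f *ₛ mono -1ℤ e) n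
  ≡⟨ cong₂ _-ℤ_ (*ₛ-oneₛ f n) (*ₛ-mono f -1ℤ e n) ⟩
    f n -ℤ shift e f n *ℤ -1ℤ
  ≡⟨ cong (λ x → f n -ℤ x) (trans (ℤ.*-comm _ -1ℤ) (ℤ.-1*i≡-i _)) ⟩
    f n -ℤ - shift e f n
  ≡⟨ cong (f n +ℤ_) (ℤ.neg-involutive _) ⟩
    f n +ℤ shift e f n ∎
  where open ≡-Reasoning

-- Partitions into distinct odd parts

oddPoch : ℕ → Series
oddPoch m = prodRange m (λ j → oneₛ -ₛ mono -1ℤ (1 + 2 * j))

-- By the definition of poch∞, oddPoch∞ n is oddPoch (suc n) n.
oddPoch∞ : Series
oddPoch∞ = poch∞ -1ℤ 1 2

oddPoch-suc : ∀ m n → oddPoch (suc m) n ≡ oddPoch m n +ℤ shift (1 + 2 * m) (oddPoch m) n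
oddPoch-suc m = *ₛ-1+q^ (oddPoch m) (1 + 2 * m)

oddPoch-nonneg : ∀ m n → 0ℤ ≤ℤ oddPoch m n
oddPoch-nonneg zero    zero    = +≤+ z≤n
oddPoch-nonneg zero    (suc n) = ℤ.≤-refl
oddPoch-nonneg (suc m) n = subst (0ℤ ≤ℤ_) (sym (oddPoch-suc m n))
  (ℤ.+-mono-≤ (oddPoch-nonneg m n) (shift-nonneg (1 + 2 * m) n (oddPoch-nonneg m)))

oddPoch-≤-suc : ∀ m n → oddPoch m n ≤ℤ oddPoch (suc m) n
oddPoch-≤-suc m n = begin
  oddPoch m n                                       ≡⟨ sym (ℤ.+-identityʳ _) ⟩
  oddPoch m n +ℤ 0ℤ
    ≤⟨ ℤ.+-monoʳ-≤ (oddPoch m n) (shift-nonneg (1 + 2 * m) n (oddPoch-nonneg m)) ⟩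
  oddPoch m n +ℤ shift (1 + 2 * m) (oddPoch m) n    ≡⟨ sym (oddPoch-suc m n) ⟩
  oddPoch (suc m) n                                 ∎
  where open ℤ.≤-Reasoning

oddPoch-suc-stable : ∀ m n → n ≤ 2 * m → oddPoch (suc m) n ≡ oddPoch m n
oddPoch-suc-stable m n n≤2m = begin
  oddPoch (suc m) n                                 ≡⟨ oddPoch-suc m n ⟩
  oddPoch m n +ℤ shift (1 + 2 * m) (oddPoch m) n    ≡⟨ cong (oddPoch m n +ℤ_) (shift-< _ _ (s≤s n≤2m)) ⟩
  oddPoch m n +ℤ 0ℤ                                 ≡⟨ ℤ.+-identityʳ _ ⟩
  oddPoch m n                                       ∎
  where open ≡-Reasoning

oddPoch-step : ∀ m n → oddPoch m (suc n) ≤ℤ oddPoch (suc m) (3 + n)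
oddPoch-step zero    n = oddPoch-nonneg 1 (3 + n)
oddPoch-step (suc m) n = begin
  oddPoch (suc m) (suc n)
    ≡⟨ oddPoch-suc m (suc n) ⟩
  oddPoch m (suc n) +ℤ shift (1 + 2 * m) (oddPoch m) (suc n)
    ≤⟨ ℤ.+-mono-≤ (oddPoch-step m n) shifted ⟩
  oddPoch (suc m) (3 + n) +ℤ shift (3 + 2 * m) (oddPoch (suc m)) (3 + n)
    ≡⟨ cong (λ e → oddPoch (suc m) (3 + n) +ℤ shift (1 + e) (oddPoch (suc m)) (3 + n))
            (sym (ℕ.*-suc 2 m)) ⟩
  oddPoch (suc m) (3 + n) +ℤ shift (1 + 2 * suc m) (oddPoch (suc m)) (3 + n)
    ≡⟨ sym (oddPoch-suc (suc m) (3 + n)) ⟩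
  oddPoch (suc (suc m)) (3 + n)                                       ∎
  where
  open ℤ.≤-Reasoning
  shifted : shift (1 + 2 * m) (oddPoch m) (suc n) ≤ℤ shift (3 + 2 * m) (oddPoch (suc m)) (3 + n)
  shifted with ℕ.≤-<-connex (1 + 2 * m) (suc n)
  ... | inj₁ le = subst₂ _≤ℤ_ (sym (shift-≥ _ _ le)) (sym (shift-≥ _ _ (s≤s (s≤s le))))
                         (oddPoch-≤-suc m (n ∸ 2 * m))
  ... | inj₂ lt = subst (_≤ℤ shift (3 + 2 * m) (oddPoch (suc m)) (3 + n))
                         (sym (shift-< (1 + 2 * m) (oddPoch m) lt))
                         (shift-nonneg (3 + 2 * m) (3 + n) (oddPoch-nonneg (suc m)))

oddPoch∞-nonneg : ∀ n → 0ℤ ≤ℤ oddPoch∞ n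
oddPoch∞-nonneg n = oddPoch-nonneg (suc n) n

oddPoch∞-step : ∀ n → oddPoch∞ (suc n) ≤ℤ oddPoch∞ (3 + n)
oddPoch∞-step n = ℤ.≤-trans (oddPoch-step (2 + n) n)
  (ℤ.≤-reflexive (sym (oddPoch-suc-stable (3 + n) (3 + n) (ℕ.m≤n*m (3 + n) 2))))

oddPoch∞-+2j : ∀ j n → oddPoch∞ (suc n) ≤ℤ oddPoch∞ (2 * j + suc n)
oddPoch∞-+2j zero    n = ℤ.≤-refl
oddPoch∞-+2j (suc j) n = ℤ.≤-trans (oddPoch∞-step n)
  (subst (λ k → oddPoch∞ (3 + n) ≤ℤ oddPoch∞ k) (+2j-shuffle j n) (oddPoch∞-+2j j (2 + n)))
  where
  +2j-shuffle : ∀ j n → 2 * j + (3 + n) ≡ 2 * suc j + suc n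
  +2j-shuffle = ℕ-Solver.solve-∀

oddPoch∞-+2j-except : ∀ n j → (n , j) ≢ (0 , 1) → oddPoch∞ n ≤ℤ oddPoch∞ (2 * j + n)
oddPoch∞-+2j-except (suc n) j               _   = oddPoch∞-+2j j n
oddPoch∞-+2j-except zero    zero            _   = ℤ.≤-refl
oddPoch∞-+2j-except zero    (suc zero)      ≢01 = contradiction refl ≢01
oddPoch∞-+2j-except zero    (suc (suc j))   _   =
  subst₂ _≤ℤ_ oddPoch∞-4≡0 (cong oddPoch∞ (4-shuffle j)) (oddPoch∞-+2j j 3)
  where
  -- 4 = 1 + 3 is the only partition of 4 into distinct odd parts.
  oddPoch∞-4≡0 : oddPoch∞ 4 ≡ oddPoch∞ 0
  oddPoch∞-4≡0 = refl
  4-shuffle : ∀ j → 2 * j + 4 ≡ 2 * suc (suc j) + 0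
  4-shuffle = ℕ-Solver.solve-∀

shift-+2j-antitone : ∀ x j M → (x + 2 * j , j) ≢ (M , 1) →
                     shift (x + 2 * j) oddPoch∞ M ≤ℤ shift x oddPoch∞ M
shift-+2j-antitone x j M ≢M1 with ℕ.≤-<-connex (x + 2 * j) M
... | inj₂ M<x+2j = subst (_≤ℤ shift x oddPoch∞ M) (sym (shift-< (x + 2 * j) oddPoch∞ M<x+2j))
                          (shift-nonneg x M oddPoch∞-nonneg)
... | inj₁ x+2j≤M = subst₂ _≤ℤ_ (sym (shift-≥ (x + 2 * j) oddPoch∞ x+2j≤M))
                               (trans (cong oddPoch∞ (sym M∸x≡2j+n)) (sym (shift-≥ x oddPoch∞ x≤M)))
                               (oddPoch∞-+2j-except n j n,j≢0,1)
  where
  n = M ∸ (x + 2 * j)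
  x≤M : x ≤ M
  x≤M = ℕ.≤-trans (ℕ.m≤m+n x (2 * j)) x+2j≤M
  M∸x≡2j+n : M ∸ x ≡ 2 * j + n
  M∸x≡2j+n = begin
    M ∸ x                  ≡⟨ cong (_∸ x) (sym (ℕ.m+[n∸m]≡n x+2j≤M)) ⟩
    x + 2 * j + n ∸ x      ≡⟨ cong (_∸ x) (ℕ.+-assoc x (2 * j) n) ⟩
    x + (2 * j + n) ∸ x    ≡⟨ ℕ.m+n∸m≡n x (2 * j + n) ⟩
    2 * j + n              ∎
    where open ≡-Reasoning
  n,j≢0,1 : (n , j) ≢ (0 , 1)
  n,j≢0,1 n,j≡0,1 = ≢M1 (cong₂ _,_ (ℕ.≤-antisym x+2j≤M (ℕ.m∸n≡0⇒m≤n (cong proj₁ n,j≡0,1)))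
                                    (cong proj₂ n,j≡0,1))

-- The two Lambert series

-- Σ_{i,t ≥ 0} q^(e i t); truncating to i, t ≤ N is exact as soon as e i t ≥ i, t.
latticeSeries : (ℕ → ℕ → ℕ) → Series
latticeSeries e N = sumRange (suc N) (λ i → sumRange (suc N) (λ t → mono 1ℤ (e i t) N))

latticeSeries-extend : ∀ e → (∀ i t → i ≤ e i t × t ≤ e i t) → ∀ {N K} → N ≤ K →
  latticeSeries e N ≡ sumRange (suc K) (λ i → sumRange (suc K) (λ t → mono 1ℤ (e i t) N))
latticeSeries-extend e e≥ {N} {K} N≤K =
  trans (sumRange-cong (suc N) (λ i _ → sumRange-extend-≤ (s≤s N≤K) λ t N<t →
           mono-< 1ℤ (e i t) N (ℕ.<-≤-trans N<t (proj₂ (e≥ i t)))))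
        (sumRange-extend-≤ (s≤s N≤K) λ i N<i → sumRange-zero (suc K) λ t _ →
           mono-< 1ℤ (e i t) N (ℕ.<-≤-trans N<i (proj₁ (e≥ i t))))

*ₛ-latticeSeries : ∀ e → (∀ i t → i ≤ e i t × t ≤ e i t) → ∀ f M →
  (f *ₛ latticeSeries e) M ≡ sumRange (suc M) (λ i → sumRange (suc M) (λ t → shift (e i t) f M))
*ₛ-latticeSeries e e≥ f M = begin
    (f *ₛ latticeSeries e) M
  ≡⟨ *ₛ-congʳ f M (λ N N≤M → latticeSeries-extend e e≥ N≤M) ⟩
    (f *ₛ (λ N → sumRange (suc M) (λ i → sumRange (suc M) (λ t → mono 1ℤ (e i t) N)))) M
  ≡⟨ *ₛ-sumRange f (suc M) (λ i N → sumRange (suc M) (λ t → mono 1ℤ (e i t) N)) M ⟩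
    sumRange (suc M) (λ i → (f *ₛ (λ N → sumRange (suc M) (λ t → mono 1ℤ (e i t) N))) M)
  ≡⟨ sumRange-cong (suc M) (λ i _ → *ₛ-sumRange f (suc M) (λ t → mono 1ℤ (e i t)) M) ⟩
    sumRange (suc M) (λ i → sumRange (suc M) (λ t → (f *ₛ mono 1ℤ (e i t)) M))
  ≡⟨ sumRange-cong (suc M) (λ i _ → sumRange-cong (suc M) λ t _ →
       trans (*ₛ-mono f 1ℤ (e i t) M) (ℤ.*-identityʳ _)) ⟩
    sumRange (suc M) (λ i → sumRange (suc M) (λ t → shift (e i t) f M)) ∎
  where open ≡-Reasoning

shift-inv1m : ∀ a b N → 1 ≤ b → shift a (inv1m b) N ≡ sumRange (suc N) (λ t → mono 1ℤ (a + b * t) N)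
shift-inv1m a b N 1≤b with ℕ.≤-<-connex a N
... | inj₁ a≤N = begin
    shift a (inv1m b) N
  ≡⟨ shift-≥ a (inv1m b) a≤N ⟩
    sumRange (suc (N ∸ a)) (λ t → mono 1ℤ (b * t) (N ∸ a))
  ≡⟨ sumRange-extend-≤ (s≤s (ℕ.m∸n≤m N a)) (λ t N∸a<t →
       mono-< 1ℤ (b * t) (N ∸ a) (ℕ.<-≤-trans N∸a<t (ℕ.m≤n*m t b {{>-nonZero 1≤b}}))) ⟩
    sumRange (suc N) (λ t → mono 1ℤ (b * t) (N ∸ a))
  ≡⟨ sumRange-cong (suc N) (λ t _ → mono-cong 1ℤ (mk⇔
       (λ bt≡N∸a → trans (cong (a +_) bt≡N∸a) (ℕ.m+[n∸m]≡n a≤N))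
       (λ a+bt≡N → trans (sym (ℕ.m+n∸m≡n a (b * t))) (cong (_∸ a) a+bt≡N)))) ⟩
    sumRange (suc N) (λ t → mono 1ℤ (a + b * t) N) ∎
  where open ≡-Reasoning
... | inj₂ N<a = trans (shift-< a (inv1m b) N<a) (sym (sumRange-zero (suc N) λ t _ →
                   mono-< 1ℤ (a + b * t) N (ℕ.<-≤-trans N<a (ℕ.m≤m+n a (b * t)))))

-- Exponents of the t-th term of the i-th summand of sum1 and of the (k+1)-st summand of sum2.
exp₁ exp₂ : ℕ → ℕ → ℕ → ℕ
exp₁ r i t = 2 * (2 * i * r + 1) + 2 * (2 * i * r + 1) * t
exp₂ r k t = 2 * suc k * r + 4 * suc k * r * t

1≤2*[n+1] : ∀ n → 1 ≤ 2 * (n + 1)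
1≤2*[n+1] n = ℕ.≤-trans (ℕ.m≤n+m 1 n) (ℕ.m≤n*m (n + 1) 2)

sum1≡latticeSeries : ∀ r N → sum1 r N ≡ latticeSeries (exp₁ r) N
sum1≡latticeSeries r N = sumRange-cong (suc N) λ i _ →
  let a = 2 * (2 * i * r + 1) in
  trans (mono-*ₛ 1ℤ a (inv1m a) N)
        (trans (ℤ.*-identityˡ _) (shift-inv1m a a N (1≤2*[n+1] (2 * i * r))))

sum2≡latticeSeries : ∀ r N → sum2 (suc r) N ≡ latticeSeries (exp₂ (suc r)) N
sum2≡latticeSeries r N = sumRange-cong (suc N) λ k _ →
  trans (mono-*ₛ 1ℤ (2 * suc k * suc r) (inv1m (4 * suc k * suc r)) N)
        (trans (ℤ.*-identityˡ _) (shift-inv1m (2 * suc k * suc r) (4 * suc k * suc r) N (s≤s z≤n)))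

exp₁-≥ : ∀ r i t → i ≤ exp₁ (suc r) i t × t ≤ exp₁ (suc r) i t
exp₁-≥ r i t = ℕ.≤-trans i≤a (ℕ.m≤m+n a (a * t))
             , ℕ.≤-trans (ℕ.m≤n*m t a {{>-nonZero 1≤a}}) (ℕ.m≤n+m (a * t) a)
  where
  x = 2 * i * suc r
  a = 2 * (x + 1)
  1≤a : 1 ≤ a
  1≤a = 1≤2*[n+1] x
  i≤a : i ≤ a
  i≤a = ℕ.≤-trans (ℕ.≤-trans (ℕ.m≤n*m i 2) (ℕ.m≤m*n (2 * i) (suc r)))
                  (ℕ.≤-trans (ℕ.m≤m+n x 1) (ℕ.m≤n*m (x + 1) 2))

exp₂-≥ : ∀ r k t → k ≤ exp₂ (suc r) k t × t ≤ exp₂ (suc r) k t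
exp₂-≥ r k t = ℕ.≤-trans k≤a (ℕ.m≤m+n a (b * t))
             , ℕ.≤-trans (ℕ.m≤n*m t b) (ℕ.m≤n+m (b * t) a)
  where
  a = 2 * suc k * suc r
  b = 4 * suc k * suc r
  k≤a : k ≤ a
  k≤a = ℕ.≤-trans (ℕ.n≤1+n k) (ℕ.≤-trans (ℕ.m≤n*m (suc k) 2) (ℕ.m≤m*n (2 * suc k) (suc r)))

exp₂≡exp₁+2j : ∀ r i t → exp₂ (suc r) t i ≡ exp₁ (suc r) i t + 2 * (suc t * r)
exp₂≡exp₁+2j = exp-identity
  where
  -- Unfolded, since the ring solver does not look through exp₁ and exp₂.
  exp-identity : ∀ r i t → 2 * suc t * suc r + 4 * suc t * suc r * i
                         ≡ (2 * (2 * i * suc r + 1) + 2 * (2 * i * suc r + 1) * t) + 2 * (suc t * r)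
  exp-identity = ℕ-Solver.solve-∀

-- Pairing the two Lambert series

pairedTerm : ℕ → ℕ → ℕ → ℕ → ℤ
pairedTerm r M i t = shift (exp₁ r i t) oddPoch∞ M -ℤ shift (exp₂ r t i) oddPoch∞ M

coefficientSum : ℕ → ℕ → ℤ
coefficientSum r M = sumRange (suc M) (λ i → sumRange (suc M) (pairedTerm r M i))

thm61Series≡coefficientSum : ∀ r M → thm61Series (suc r) M ≡ coefficientSum (suc r) M
thm61Series≡coefficientSum r M = begin
    thm61Series (suc r) M
  ≡⟨ *ₛ-distribˡ--ₛ oddPoch∞ (sum1 (suc r)) (sum2 (suc r)) M ⟩
    (oddPoch∞ *ₛ sum1 (suc r)) M -ℤ (oddPoch∞ *ₛ sum2 (suc r)) M
  ≡⟨ cong₂ _-ℤ_ (*ₛ-congʳ oddPoch∞ M (λ N _ → sum1≡latticeSeries (suc r) N))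
                (*ₛ-congʳ oddPoch∞ M (λ N _ → sum2≡latticeSeries r N)) ⟩
    (oddPoch∞ *ₛ latticeSeries (exp₁ (suc r))) M -ℤ (oddPoch∞ *ₛ latticeSeries (exp₂ (suc r))) M
  ≡⟨ cong₂ _-ℤ_ (*ₛ-latticeSeries (exp₁ (suc r)) (exp₁-≥ r) oddPoch∞ M)
                (*ₛ-latticeSeries (exp₂ (suc r)) (exp₂-≥ r) oddPoch∞ M) ⟩
    Σ² F₁ -ℤ Σ² F₂
  ≡⟨ cong (Σ² F₁ -ℤ_) (sumRange-swap (suc M) (suc M) F₂) ⟩
    Σ² F₁ -ℤ Σ² (λ i t → F₂ t i)
  ≡⟨ sym (sumRange-- (suc M) _ _) ⟩
    sumRange (suc M) (λ i → sumRange (suc M) (F₁ i) -ℤ sumRange (suc M) (λ t → F₂ t i))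
  ≡⟨ sumRange-cong (suc M) (λ i _ → sym (sumRange-- (suc M) _ _)) ⟩
    coefficientSum (suc r) M ∎
  where
  open ≡-Reasoning
  Σ² : (ℕ → ℕ → ℤ) → ℤ
  Σ² D = sumRange (suc M) (λ i → sumRange (suc M) (D i))
  F₁ F₂ : ℕ → ℕ → ℤ
  F₁ i t = shift (exp₁ (suc r) i t) oddPoch∞ M
  F₂ k t = shift (exp₂ (suc r) k t) oddPoch∞ M

pairedTerm-nonneg : ∀ r M i t → (exp₂ (suc r) t i , suc t * r) ≢ (M , 1) →
                    0ℤ ≤ℤ pairedTerm (suc r) M i t
pairedTerm-nonneg r M i t ≢M1 = ℤ.i≤j⇒0≤j-i
  (subst (λ e → shift e oddPoch∞ M ≤ℤ shift x oddPoch∞ M) (sym exp₂≡x+2j)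
         (shift-+2j-antitone x j M (≢M1 ∘ subst (λ e → (e , j) ≡ (M , 1)) (sym exp₂≡x+2j))))
  where
  x = exp₁ (suc r) i t
  j = suc t * r
  exp₂≡x+2j : exp₂ (suc r) t i ≡ x + 2 * j
  exp₂≡x+2j = exp₂≡exp₁+2j r i t

coefficientSum-nonneg-unexceptional : ∀ r M → (∀ i t → (exp₂ (suc r) t i , suc t * r) ≢ (M , 1)) →
                                      0ℤ ≤ℤ coefficientSum (suc r) M
coefficientSum-nonneg-unexceptional r M ≢M1 =
  sumRange-nonneg (suc M) λ i _ → sumRange-nonneg (suc M) λ t _ → pairedTerm-nonneg r M i t (≢M1 i t)

exceptional-r≡2 : ∀ M i t → (exp₂ 2 t i , suc t * 1) ≡ (M , 1) → t ≡ 0 × 4 + 8 * i ≡ M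
exceptional-r≡2 M i zero    refl = refl , refl
exceptional-r≡2 M i (suc t) ()

≡4[mod8]? : ∀ M → Dec (∃ λ i → 4 + 8 * i ≡ M)
≡4[mod8]? M with M % 8 ≟ 4
... | yes M%8≡4 = yes (M / 8 , sym (trans (m≡m%n+[m/n]*n M 8) (cong₂ _+_ M%8≡4 (ℕ.*-comm (M / 8) 8))))
... | no  M%8≢4 = no λ { (i , refl) →
  M%8≢4 (trans (cong (λ k → (4 + k) % 8) (ℕ.*-comm 8 i)) ([m+kn]%n≡m%n 4 i 8)) }

coefficientSum-nonneg-exceptional : ∀ i₀ → 0ℤ ≤ℤ coefficientSum 2 (4 + 8 * i₀)
coefficientSum-nonneg-exceptional i₀ =
  doubleSum-nonneg-except (suc M) (suc M) (pairedTerm 2 M) i₀ 0 0 t₀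
                          i₀<1+M (s≤s z≤n) (s≤s z≤n) t₀<1+M (λ ()) others total
  where
  M = 4 + 8 * i₀
  t₀ = suc (4 * i₀)
  i₀<1+M : i₀ < suc M
  i₀<1+M = s≤s (ℕ.≤-trans (ℕ.m≤n*m i₀ 8) (ℕ.m≤n+m (8 * i₀) 4))
  t₀<1+M : t₀ < suc M
  t₀<1+M = s≤s (ℕ.+-mono-≤ (ℕ.m≤m+n 1 3) (ℕ.*-monoˡ-≤ i₀ (ℕ.m≤m+n 4 4)))
  others : ∀ i t → i < suc M → t < suc M → (i , t) ≢ (i₀ , 0) → 0ℤ ≤ℤ pairedTerm 2 M i t
  others i t _ _ ≢i₀,0 = pairedTerm-nonneg 1 M i t λ eq →
    let t≡0 , 4+8i≡M = exceptional-r≡2 M i t eq in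
    ≢i₀,0 (cong₂ _,_ (ℕ.*-cancelˡ-≡ i i₀ 8 (ℕ.+-cancelˡ-≡ 4 _ _ 4+8i≡M)) t≡0)
  hit : shift (exp₁ 2 0 t₀) oddPoch∞ M ≡ 1ℤ
  hit = trans (cong (λ e → shift e oddPoch∞ M) (2+2*t₀≡M i₀)) (shift-self oddPoch∞ M)
    where
    2+2*t₀≡M : ∀ i → 2 + 2 * suc (4 * i) ≡ 4 + 8 * i
    2+2*t₀≡M = ℕ-Solver.solve-∀
  miss : shift (exp₂ 2 t₀ 0) oddPoch∞ M ≡ 0ℤ
  miss = shift-< (exp₂ 2 t₀ 0) oddPoch∞
    (ℕ.≤-trans (subst (suc M ≤_) (sym (4*[1+t₀]≡1+M+_ i₀)) (ℕ.m≤m+n (suc M) _)) (ℕ.m≤m+n _ _))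
    where
    4*[1+t₀]≡1+M+_ : ∀ i → 2 * suc (suc (4 * i)) * 2 ≡ suc (4 + 8 * i) + (3 + 8 * i)
    4*[1+t₀]≡1+M+_ = ℕ-Solver.solve-∀
  s = shift (exp₁ 2 i₀ 0) oddPoch∞ M
  total : 0ℤ ≤ℤ pairedTerm 2 M i₀ 0 +ℤ pairedTerm 2 M 0 t₀
  total = subst (0ℤ ≤ℤ_) (sym pair≡s) (shift-nonneg (exp₁ 2 i₀ 0) M oddPoch∞-nonneg)
    where
    pair≡s : pairedTerm 2 M i₀ 0 +ℤ pairedTerm 2 M 0 t₀ ≡ s
    pair≡s = begin
      pairedTerm 2 M i₀ 0 +ℤ pairedTerm 2 M 0 t₀
        ≡⟨ cong₂ _+ℤ_ (cong (s -ℤ_) (shift-self oddPoch∞ M)) (cong₂ _-ℤ_ hit miss) ⟩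
      (s -ℤ 1ℤ) +ℤ (1ℤ -ℤ 0ℤ)  ≡⟨ ℤ.+-assoc s -1ℤ 1ℤ ⟩
      s +ℤ 0ℤ                  ≡⟨ ℤ.+-identityʳ s ⟩
      s                        ∎
      where open ≡-Reasoning

coefficientSum-nonneg : ∀ r M → 0ℤ ≤ℤ coefficientSum (suc r) M
coefficientSum-nonneg r M with r ≟ 1
... | no r≢1 = coefficientSum-nonneg-unexceptional r M λ i t eq →
                 r≢1 (ℕ.m*n≡1⇒n≡1 (suc t) r (cong proj₂ eq))
... | yes refl with ≡4[mod8]? M
...   | yes (i₀ , refl) = coefficientSum-nonneg-exceptional i₀
...   | no  ∄i          = coefficientSum-nonneg-unexceptional 1 M λ i t eq →
                            ∄i (i , proj₂ (exceptional-r≡2 M i t eq))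

theorem6p1 : (r : ℕ) → 1 ≤ r → (n : ℕ) → 0ℤ ≤ℤ thm61Series r n
theorem6p1 (suc r) _ M = subst (0ℤ ≤ℤ_) (sym (thm61Series≡coefficientSum r M)) (coefficientSum-nonneg r M)
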